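{- For all integers $n\ge 3$, \[ 2\cdot M(n)\le M(n+1). \]
   Context: For a finite simple graph $G$ on vertex set $[n]$, $P_G=\operatorname{conv}\{\pm(e_i-e_j):\{i,j\}\in E(G)\}\subset\mathbb{R}^n$ is the symmetric edge polytope, and $N(P)$ is the number of facets of a polytope $P$. With $C_m$ the $m$-edge cycle, $e$ a single edge, and $\vee$ denoting a wedge (identification of one vertex from each graph), $M(n)=N(P_G)$ where $G=C_{k+1}\vee C_{k-1}$ if $n=2k-1$, $k$ even; $G=C_k\vee C_k$ if $n=2k-1$, $k$ odd; $G=C_{k+1}\vee C_{k-1}\vee e$ if $n=2k$, $k$ even; $G=C_k\vee C_k\vee e$ if $n=2k$, $k$ odd. Equivalently, $M(2k-1)=(k+1)(k-1)\binom{k}{k/2}\binom{k-2}{(k-2)/2}$ for $k$ even, $M(2k-1)=k^2\binom{k-1}{(k-1)/2}^2$ for $k$ odd, and $M(2k)=2M(2k-1)$; for $n=3,4$ (where the graph definition formally involves $C_1$) these formulas serve as the definition, giving $M(3)=6$, $M(4)=12$. -}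

module Defs where

open import Data.Nat using (ℕ; zero; suc; _+_; _*_; _∸_; _^_)
open import Data.Nat.Combinatorics using (_C_)
open import Data.Nat.Properties using (+-suc)
open import Relation.Binary.PropositionalEquality using (subst; cong)

-- Mk k = M(2k-1), the closed formula from the paper (k ≥ 2):
--   k even: (k+1)(k-1) C(k,k/2) C(k-2,(k-2)/2)
--   k odd : k^2 C(k-1,(k-1)/2)^2
-- Defined by recursion on the parity of k:
--   k = 2m   : (2m+1)(2m-1) * C(2m,m) * C(2m-2,m-1)
--   k = 2m+1 : (2m+1)^2 * C(2m,m)^2
data Parity : ℕ → Set where
  even : (m : ℕ) → Parity (m + m)
  odd  : (m : ℕ) → Parity (suc (m + m))

parity : (k : ℕ) → Parity k
parity zero = even zero
parity (suc k) with parity k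
... | even m = odd m
... | odd m = subst Parity (cong suc (+-suc m m)) (even (suc m))

Mk : ℕ → ℕ
Mk k with parity k
... | even m = (m + m + 1) * (m + m ∸ 1) * ((m + m) C m) * ((m + m ∸ 2) C (m ∸ 1))
... | odd m = ((m + m + 1) ^ 2) * (((m + m) C m) ^ 2)

M : ℕ → ℕ
M n with parity n
... | even k = 2 * Mk k
... | odd m = Mk (suc m)

{-# OPTIONS --safe #-}
-- Put rootMk m = (2m+1)·C(2m,m). The closed formulas say Mk (2m+1) = rootMk m ² and
-- Mk (2m+2) = rootMk m · rootMk (m+1), so each step k ↦ k+1 multiplies Mk by some
-- rootMk (m+1) / rootMk m. The central binomial recurrence
-- (m+1)·C(2m+2,m+1) = 2(2m+1)·C(2m,m) turns this ratio into 4(2m+3)/(2m+2) ≥ 4,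
-- so Mk (k+1) ≥ 4 Mk k. As M (2k) = 2 Mk k and M (2k+1) = Mk (k+1), going from an
-- even n to n+1 gains a factor ≥ 2, and from an odd n to n+1 exactly 2.
module Submission where

open import Defs
open import Data.Nat using (ℕ; zero; suc; _+_; _*_; _≤_; z≤n; ⌊_/2⌋)
open import Data.Nat.Combinatorics using (_C_; nC1≡n; nCk≡nC[n∸k]; nCk+nC[k+1]≡[n+1]C[k+1])
open import Data.Nat.Properties
open import Data.Nat.Tactic.RingSolver using (solve-∀)
open import Algebra.Properties.CommutativeSemigroup *-commutativeSemigroup using (x∙yz≈y∙xz)
open import Data.Empty using (⊥-elim)
open import Relation.Binary.PropositionalEquality

m+m-injective : ∀ {m n} → m + m ≡ n + n → m ≡ n
m+m-injective {m} {n} eq = trans (n≡⌊n+n/2⌋ m) (trans (cong ⌊_/2⌋ eq) (sym (n≡⌊n+n/2⌋ n)))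

m+m≢1+n+n : ∀ m n → m + m ≢ suc (n + n)
m+m≢1+n+n m n eq = even≢odd m n (trans (cong (m +_) (+-identityʳ m))
  (trans eq (cong (λ x → suc (n + x)) (sym (+-identityʳ n)))))

-- Defs' parity passes through a subst, so M (k + k) does not compute until
-- parity (k + k) is rewritten to even k, which needs Parity n to be a proposition.
Parity-subst-irrelevant : ∀ {a b} (e : a ≡ b) (p : Parity a) (q : Parity b) → subst Parity e p ≡ q
Parity-subst-irrelevant e (even j) (even k) with m+m-injective {j} {k} e
... | refl rewrite ≡-irrelevant e refl = refl
Parity-subst-irrelevant e (even j) (odd k) = ⊥-elim (m+m≢1+n+n j k e)
Parity-subst-irrelevant e (odd j) (even k) = ⊥-elim (m+m≢1+n+n k j (sym e))
Parity-subst-irrelevant e (odd j) (odd k) with m+m-injective {j} {k} (suc-injective e)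
... | refl rewrite ≡-irrelevant e refl = refl

Parity-irrelevant : ∀ {n} (p q : Parity n) → p ≡ q
Parity-irrelevant = Parity-subst-irrelevant refl

parity-even : ∀ k → parity (k + k) ≡ even k
parity-even k = Parity-irrelevant (parity (k + k)) (even k)

parity-odd : ∀ k → parity (suc (k + k)) ≡ odd k
parity-odd k rewrite parity-even k = refl

M-even : ∀ k → M (k + k) ≡ 2 * Mk k
M-even k rewrite parity-even k = refl

M-odd : ∀ k → M (suc (k + k)) ≡ Mk (suc k)
M-odd k rewrite parity-odd k = refl

[k+1]*[n+1]C[k+1]≡[n+1]*nCk : ∀ n k → suc k * (suc n C suc k) ≡ suc n * (n C k)
[k+1]*[n+1]C[k+1]≡[n+1]*nCk n zero = trans (+-identityʳ _) (trans (nC1≡n (suc n)) (sym (*-identityʳ (suc n))))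
[k+1]*[n+1]C[k+1]≡[n+1]*nCk zero (suc k) = *-zeroʳ (suc (suc k))
[k+1]*[n+1]C[k+1]≡[n+1]*nCk (suc n) (suc k) = begin
  suc (suc k) * (suc (suc n) C suc (suc k))   ≡⟨ cong (suc (suc k) *_) (nCk+nC[k+1]≡[n+1]C[k+1] (suc n) (suc k)) ⟨
  suc (suc k) * (A + B)                       ≡⟨ *-distribˡ-+ (suc (suc k)) A B ⟩
  A + suc k * A + suc (suc k) * B             ≡⟨ cong₂ (λ x y → A + x + y) ([k+1]*[n+1]C[k+1]≡[n+1]*nCk n k) ([k+1]*[n+1]C[k+1]≡[n+1]*nCk n (suc k)) ⟩
  A + suc n * (n C k) + suc n * (n C suc k)   ≡⟨ +-assoc A _ _ ⟩
  A + (suc n * (n C k) + suc n * (n C suc k)) ≡⟨ cong (A +_) (*-distribˡ-+ (suc n) (n C k) (n C suc k)) ⟨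
  A + suc n * (n C k + n C suc k)             ≡⟨ cong (λ x → A + suc n * x) (nCk+nC[k+1]≡[n+1]C[k+1] n k) ⟩
  A + suc n * A                               ∎
  where
  open ≡-Reasoning
  A B : ℕ
  A = suc n C suc k
  B = suc n C suc (suc k)

rootMk : ℕ → ℕ
rootMk m = suc (m + m) * ((m + m) C m)

[1+m]*[2+2m]C[1+m]≡2*rootMk : ∀ m → suc m * ((suc m + suc m) C suc m) ≡ 2 * rootMk m
[1+m]*[2+2m]C[1+m]≡2*rootMk m = *-cancelˡ-≡ _ _ (suc m) (begin
  suc m * (suc m * ((suc m + suc m) C suc m))         ≡⟨ cong (λ n → suc m * (suc m * (suc n C suc m))) (+-suc m m) ⟩
  suc m * (suc m * (suc (suc (m + m)) C suc m))       ≡⟨ cong (suc m *_) ([k+1]*[n+1]C[k+1]≡[n+1]*nCk (suc (m + m)) m) ⟩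
  suc m * (suc (suc (m + m)) * (suc (m + m) C m))     ≡⟨ cong (λ x → suc m * (suc (suc (m + m)) * x)) [2m+1]Cm≡[2m+1]C[m+1] ⟩
  suc m * (suc (suc (m + m)) * (suc (m + m) C suc m)) ≡⟨ x∙yz≈y∙xz (suc m) (suc (suc (m + m))) (suc (m + m) C suc m) ⟩
  suc (suc (m + m)) * (suc m * (suc (m + m) C suc m)) ≡⟨ cong (suc (suc (m + m)) *_) ([k+1]*[n+1]C[k+1]≡[n+1]*nCk (m + m) m) ⟩
  suc (suc (m + m)) * rootMk m                        ≡⟨ [2+2m]*r≡[1+m]*[2*r] m (rootMk m) ⟩
  suc m * (2 * rootMk m)                              ∎)
  where
  open ≡-Reasoning
  [2m+1]Cm≡[2m+1]C[m+1] : suc (m + m) C m ≡ suc (m + m) C suc m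
  [2m+1]Cm≡[2m+1]C[m+1] = trans (nCk≡nC[n∸k] (m≤n⇒m≤1+n (m≤m+n m m))) (cong (suc (m + m) C_) (m+n∸n≡m (suc m) m))
  [2+2m]*r≡[1+m]*[2*r] : ∀ k r → suc (suc (k + k)) * r ≡ suc k * (2 * r)
  [2+2m]*r≡[1+m]*[2*r] = solve-∀

4*rootMk≤rootMk[1+m] : ∀ m → 4 * rootMk m ≤ rootMk (suc m)
4*rootMk≤rootMk[1+m] m = begin
  4 * rootMk m                ≡⟨ *-distribʳ-+ (rootMk m) 2 2 ⟩
  2 * rootMk m + 2 * rootMk m ≡⟨ cong₂ _+_ recurrence recurrence ⟨
  suc m * c + suc m * c       ≡⟨ *-distribʳ-+ c (suc m) (suc m) ⟨
  (suc m + suc m) * c         ≤⟨ *-monoˡ-≤ c (n≤1+n (suc m + suc m)) ⟩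
  rootMk (suc m)              ∎
  where
  open ≤-Reasoning
  c : ℕ
  c = (suc m + suc m) C suc m
  recurrence : suc m * c ≡ 2 * rootMk m
  recurrence = [1+m]*[2+2m]C[1+m]≡2*rootMk m

Mk-odd : ∀ m → Mk (suc (m + m)) ≡ rootMk m * rootMk m
Mk-odd m rewrite parity-odd m = square (m + m) ((m + m) C m)
  where
  -- x ^ 2 is spelled out as x * (x * 1), the form in which the solver accepts it
  square : ∀ a c → (a + 1) * ((a + 1) * 1) * (c * (c * 1)) ≡ suc a * c * (suc a * c)
  square = solve-∀

Mk-even : ∀ m → Mk (suc m + suc m) ≡ rootMk m * rootMk (suc m)
Mk-even m rewrite parity-even (suc m) | +-suc m m = regroup (m + m) ((m + m) C m) (suc (suc (m + m)) C suc m)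
  where
  regroup : ∀ a c d → (suc (suc a) + 1) * suc a * d * c ≡ suc a * c * (suc (suc (suc a)) * d)
  regroup = solve-∀

4*Mk≤Mk[1+k] : ∀ {k} → Parity k → 4 * Mk k ≤ Mk (suc k)
4*Mk≤Mk[1+k] (even zero) = z≤n
4*Mk≤Mk[1+k] (even (suc m)) = begin
  4 * Mk (suc m + suc m)            ≡⟨ cong (4 *_) (Mk-even m) ⟩
  4 * (rootMk m * rootMk (suc m))   ≡⟨ *-assoc 4 (rootMk m) (rootMk (suc m)) ⟨
  4 * rootMk m * rootMk (suc m)     ≤⟨ *-monoˡ-≤ (rootMk (suc m)) (4*rootMk≤rootMk[1+m] m) ⟩
  rootMk (suc m) * rootMk (suc m)   ≡⟨ Mk-odd (suc m) ⟨
  Mk (suc (suc m + suc m))          ∎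
  where open ≤-Reasoning
4*Mk≤Mk[1+k] (odd m) = begin
  4 * Mk (suc (m + m))              ≡⟨ cong (4 *_) (Mk-odd m) ⟩
  4 * (rootMk m * rootMk m)         ≡⟨ *-assoc 4 (rootMk m) (rootMk m) ⟨
  4 * rootMk m * rootMk m           ≤⟨ *-monoˡ-≤ (rootMk m) (4*rootMk≤rootMk[1+m] m) ⟩
  rootMk (suc m) * rootMk m         ≡⟨ *-comm (rootMk (suc m)) (rootMk m) ⟩
  rootMk m * rootMk (suc m)         ≡⟨ Mk-even m ⟨
  Mk (suc m + suc m)                ≡⟨ cong (λ n → Mk (suc n)) (+-suc m m) ⟩
  Mk (suc (suc (m + m)))            ∎
  where open ≤-Reasoning

2*M≤M[1+n] : ∀ {n} → Parity n → 2 * M n ≤ M (suc n)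
2*M≤M[1+n] (even k) = begin
  2 * M (k + k)     ≡⟨ cong (2 *_) (M-even k) ⟩
  2 * (2 * Mk k)    ≡⟨ *-assoc 2 2 (Mk k) ⟨
  4 * Mk k          ≤⟨ 4*Mk≤Mk[1+k] (parity k) ⟩
  Mk (suc k)        ≡⟨ M-odd k ⟨
  M (suc (k + k))   ∎
  where open ≤-Reasoning
2*M≤M[1+n] (odd k) = ≤-reflexive (begin
  2 * M (suc (k + k))     ≡⟨ cong (2 *_) (M-odd k) ⟩
  2 * Mk (suc k)          ≡⟨ M-even (suc k) ⟨
  M (suc k + suc k)       ≡⟨ cong (λ n → M (suc n)) (+-suc k k) ⟩
  M (suc (suc (k + k)))   ∎)
  where open ≡-Reasoning

theorem3p8 : (n : ℕ) → 3 ≤ n → 2 * M n ≤ M (n + 1)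
theorem3p8 n _ = subst (λ m → 2 * M n ≤ M m) (+-comm 1 n) (2*M≤M[1+n] (parity n))
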